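{- Let $(M, S_{1}, S_{2}, \ldots, \#_{1}, \#_{2})$ be a structure with $S_{n}\subseteq P(M^{n})$ and $\#_{i}:S_{1}\rightarrow M$ for $i\in\{1,2\}$. Suppose that $(M, S_{1}, S_{2}, \ldots, \#_{i})$ is a model of ${\tt HP}^{2}$ for $i\in \{1,2\}$, and that $(M, S_{1}, S_{2}, \ldots, \#_{1}, \#_{2})$ satisfies every instance of the comprehension schema $\exists R\,\forall\bar n[\bar n\in R\leftrightarrow\varphi(\bar n)]$ for formulas $\varphi$ in the signature containing both function symbols $\#_1,\#_2$. For $i\in \{1,2\}$ let $\mathcal{N}_{i}=(\mathrm{rng}(\#_{i}), S_{1}\cap P(\mathrm{rng}(\#_{i})), S_{2}\cap P(\mathrm{rng}(\#_{i})^{2}), \ldots, \#_{i})$ (with $\#_i$ restricted to $S_1\cap P(\mathrm{rng}(\#_i))$). Then $\mathcal{N}_{1}$ and $\mathcal{N}_{2}$ are isomorphic models of ${\tt HP}^{2}$.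
   Context: Structures $(M,S_1,S_2,\ldots,\#)$ are many-sorted: objects $M$, $n$-ary relations $S_n$ (elements of $S_1$ are sets), and $\#:S_1\to M$. ${\tt HP}^2$ is Hume's Principle ($\#X=\#Y\leftrightarrow$ there is a bijection $f:X\to Y$ with graph in $S_2$) together with the full comprehension schema $\exists R\forall\bar n[\bar n\in R\leftrightarrow\varphi(\bar n)]$ (all formulas, parameters allowed, $R$ not free in $\varphi$). -}

module Defs where

open import Level using (0ℓ)
open import Data.Nat using (ℕ; zero; suc)
open import Data.Fin using (Fin; zero; suc)
open import Data.Bool using (Bool; true; false)
open import Data.Unit using (⊤; tt)
open import Data.Empty using (⊥)
open import Data.Product using (Σ; _×_; _,_; proj₁; proj₂; ∃-syntax)
open import Data.Sum using (_⊎_)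
open import Data.List using (List; []; _∷_; _++_; replicate)
open import Data.List.Membership.Propositional using (_∈_)
open import Data.List.Relation.Unary.All using (All; []; _∷_; lookup)
open import Function using (_∘_; _⇔_; mk⇔; Equivalence)
open import Relation.Binary using (IsEquivalence)
open import Relation.Nullary using (¬_)

-- Many-sorted second-order structures (M, S₁, S₂, …, #_f (f ∈ F)).
-- `Rel k` is the sort S_{k+1} of (k+1)-ary relations; elements of
-- relation sorts are compared extensionally (they stand for subsets of
-- M^{k+1}), and the object domain carries its equality `_≈_` (a setoid,
-- needed so that substructures can be formed without quotients).

_≗ᵥ_ : {M : Set} (_≈_ : M → M → Set) {n : ℕ} → (Fin n → M) → (Fin n → M) → Set
_≗ᵥ_ _≈_ v w = ∀ j → v j ≈ w j

record Structure (F : Set) : Set₁ where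
  field
    M      : Set
    _≈_    : M → M → Set
    ≈-eq   : IsEquivalence _≈_
    Rel    : ℕ → Set
    _∋_    : ∀ {k} → Rel k → (Fin (suc k) → M) → Set
    ∋-resp : ∀ {k} (X : Rel k) {v w : Fin (suc k) → M} →
             _≗ᵥ_ _≈_ v w → X ∋ v → X ∋ w
    #      : F → Rel 0 → M
  _≐_ : ∀ {k} → Rel k → Rel k → Set
  X ≐ Y = ∀ v → (X ∋ v) ⇔ (Y ∋ v)
  field
    #-resp : ∀ f {X Y : Rel 0} → X ≐ Y → # f X ≈ # f Y

data Sort : Set where
  obj : Sort
  rel : ℕ → Sort

Ctx : Set
Ctx = List Sort

data Term (F : Set) (Γ : Ctx) : Set where
  var  : obj ∈ Γ → Term F Γ
  hash : F → rel 0 ∈ Γ → Term F Γ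

data Formula (F : Set) (Γ : Ctx) : Set where
  _≐ₜ_ : Term F Γ → Term F Γ → Formula F Γ
  app  : ∀ {k} → rel k ∈ Γ → (Fin (suc k) → Term F Γ) → Formula F Γ
  ⊤ᶠ ⊥ᶠ : Formula F Γ
  ¬ᶠ_  : Formula F Γ → Formula F Γ
  _∧ᶠ_ _∨ᶠ_ _⇒ᶠ_ : Formula F Γ → Formula F Γ → Formula F Γ
  ∀ᶠ ∃ᶠ : (s : Sort) → Formula F (s ∷ Γ) → Formula F Γ

module Semantics {F : Set} (A : Structure F) where
  open Structure A

  ⟦_⟧ˢ : Sort → Set
  ⟦ obj ⟧ˢ   = M
  ⟦ rel k ⟧ˢ = Rel k

  Env : Ctx → Set
  Env Γ = All ⟦_⟧ˢ Γ

  evalT : ∀ {Γ} → Term F Γ → Env Γ → M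
  evalT (var x)    ρ = lookup ρ x
  evalT (hash f x) ρ = # f (lookup ρ x)

  Sat : ∀ {Γ} → Formula F Γ → Env Γ → Set
  Sat (t ≐ₜ u)   ρ = evalT t ρ ≈ evalT u ρ
  Sat (app x ts) ρ = lookup ρ x ∋ (λ j → evalT (ts j) ρ)
  Sat ⊤ᶠ         ρ = ⊤
  Sat ⊥ᶠ         ρ = ⊥
  Sat (¬ᶠ φ)     ρ = ¬ Sat φ ρ
  Sat (φ ∧ᶠ ψ)   ρ = Sat φ ρ × Sat ψ ρ
  Sat (φ ∨ᶠ ψ)   ρ = Sat φ ρ ⊎ Sat ψ ρ
  Sat (φ ⇒ᶠ ψ)   ρ = Sat φ ρ → Sat ψ ρ
  Sat (∀ᶠ s φ)   ρ = (d : ⟦ s ⟧ˢ) → Sat φ (d ∷ ρ)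
  Sat (∃ᶠ s φ)   ρ = Σ ⟦ s ⟧ˢ λ d → Sat φ (d ∷ ρ)

  extend : ∀ {Γ} n → (Fin n → M) → Env Γ → Env (replicate n obj ++ Γ)
  extend zero    v ρ = ρ
  extend (suc n) v ρ = v zero ∷ extend n (v ∘ suc) ρ

  -- Full comprehension schema: ∃R ∀n̄ [n̄ ∈ R ↔ φ(n̄)], all formulas φ
  -- (with parameters ρ; R cannot occur in φ).
  Comprehension : Set
  Comprehension = ∀ (Γ : Ctx) (k : ℕ)
    (φ : Formula F (replicate (suc k) obj ++ Γ)) (ρ : Env Γ) →
    Σ (Rel k) λ R → ∀ (v : Fin (suc k) → M) → (R ∋ v) ⇔ Sat φ (extend (suc k) v ρ)

  pair : M → M → Fin 2 → M
  pair a b zero       = a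
  pair a b (suc zero) = b

  IsBijGraph : Rel 1 → Rel 0 → Rel 0 → Set
  IsBijGraph R X Y =
      (∀ a b → R ∋ pair a b → (X ∋ λ _ → a) × (Y ∋ λ _ → b))
    × (∀ a → (X ∋ λ _ → a) → ∃[ b ] R ∋ pair a b)
    × (∀ a b b′ → R ∋ pair a b → R ∋ pair a b′ → b ≈ b′)
    × (∀ a a′ b → R ∋ pair a b → R ∋ pair a′ b → a ≈ a′)
    × (∀ b → (Y ∋ λ _ → b) → ∃[ a ] R ∋ pair a b)

  HP : F → Set
  HP f = ∀ (X Y : Rel 0) → (# f X ≈ # f Y) ⇔ (∃[ R ] IsBijGraph R X Y)

ModelHP2 : Structure ⊤ → Set
ModelHP2 A = HP tt × Comprehension
  where open Semantics A

reduct : ∀ {F F′ : Set} → Structure F → (F′ → F) → Structure F′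
reduct A σ = record
  { M = M ; _≈_ = _≈_ ; ≈-eq = ≈-eq ; Rel = Rel ; _∋_ = _∋_ ; ∋-resp = ∋-resp
  ; # = λ f → # (σ f) ; #-resp = λ f → #-resp (σ f) }
  where open Structure A

single : Structure Bool → Bool → Structure ⊤
single A i = reduct A (λ _ → i)

module Sub (A : Structure Bool) (i : Bool) where
  open Structure A
  open IsEquivalence ≈-eq

  InRng : M → Set
  InRng m = Σ (Rel 0) λ X → # i X ≈ m

  Mᵢ : Set
  Mᵢ = Σ M InRng

  Relᵢ : ℕ → Set
  Relᵢ k = Σ (Rel k) λ X → ∀ v → X ∋ v → ∀ j → InRng (v j)

  coext : ∀ {k} (X Y : Relᵢ k) →
          (∀ (v : Fin (suc k) → Mᵢ) → (proj₁ X ∋ (proj₁ ∘ v)) ⇔ (proj₁ Y ∋ (proj₁ ∘ v))) →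
          proj₁ X ≐ proj₁ Y
  coext (X , pX) (Y , pY) h v =
    mk⇔ (λ x → Equivalence.to   (h (λ j → v j , pX v x j)) x)
        (λ y → Equivalence.from (h (λ j → v j , pY v y j)) y)

  𝒩 : Structure ⊤
  𝒩 = record
    { M = Mᵢ
    ; _≈_ = λ a b → proj₁ a ≈ proj₁ b
    ; ≈-eq = record { refl = refl ; sym = sym ; trans = trans }
    ; Rel = Relᵢ
    ; _∋_ = λ X v → proj₁ X ∋ (proj₁ ∘ v)
    ; ∋-resp = λ X e → ∋-resp (proj₁ X) e
    ; # = λ _ X → # i (proj₁ X) , proj₁ X , refl
    ; #-resp = λ _ {X} {Y} h → #-resp i (coext X Y h)
    }

𝒩 : Structure Bool → Bool → Structure ⊤
𝒩 A i = Sub.𝒩 A i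

record Iso {F : Set} (A B : Structure F) : Set where
  module A = Structure A
  module B = Structure B
  field
    f        : A.M → B.M
    f-resp   : ∀ {a a′} → a A.≈ a′ → f a B.≈ f a′
    f-inj    : ∀ {a a′} → f a B.≈ f a′ → a A.≈ a′
    f-surj   : ∀ b → ∃[ a ] f a B.≈ b
    g        : ∀ {k} → A.Rel k → B.Rel k
    g-surj   : ∀ {k} (Y : B.Rel k) → ∃[ X ] B._≐_ (g X) Y
    g-mem    : ∀ {k} (X : A.Rel k) (v : Fin (suc k) → A.M) →
               (X A.∋ v) ⇔ (g X B.∋ (f ∘ v))
    #-pres   : ∀ s (X : A.Rel 0) → B.# s (g X) B.≈ f (A.# s X)

-- The relation a ↦ b :⇔ ∃Z (#₁Z = a ∧ #₂Z = b) is definable with both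
-- number operators, and it is functional and injective: by the two instances
-- of Hume's Principle, #₁X = #₁Y and #₂X = #₂Y both say that X and Y are
-- equinumerous.  Hence it is a bijection rng(#₁) → rng(#₂) sending #₁X to #₂X;
-- it carries relations of 𝒩₁ to relations of 𝒩₂ by taking images, which
-- exist by comprehension, and it commutes with the number operators because a
-- set and its image are equinumerous via the (again definable) restricted graph.
-- That each 𝒩ᵢ is a model of HP² is the usual relativisation argument:
-- quantifiers of 𝒩ᵢ become quantifiers of the full structure bounded by rng(#ᵢ).

module Submission where

open import Axiom.ExcludedMiddle using (ExcludedMiddle)
open import Defs
open import Level using (0ℓ)
open import Data.Bool using (Bool; true; false)
open import Data.Nat using (ℕ; zero; suc)
open import Data.Fin using (Fin; zero; suc)
open import Data.Unit using (⊤; tt)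
open import Data.Product using (Σ; _×_; _,_; proj₁; proj₂; ∃-syntax; map₂)
open import Data.Product.Function.Dependent.Propositional using (congˡ)
open import Data.Product.Function.NonDependent.Propositional using (_×-⇔_)
open import Data.Sum.Function.Propositional using (_⊎-⇔_)
open import Data.List using ([]; _∷_; _++_; replicate)
open import Data.List.Membership.Propositional using (_∈_)
open import Data.List.Relation.Unary.Any using (here; there)
open import Data.List.Relation.Unary.All using ([]; _∷_; lookup)
open import Data.Vec.Functional using () renaming (_∷_ to _◂_)
open import Function using (_∘_; _⇔_; mk⇔; Equivalence)
open import Function.Construct.Composition using (_⇔-∘_)
open import Function.Construct.Identity using (⇔-id)
open import Function.Construct.Symmetry using (⇔-sym)
open import Function.Related.Propositional using (≡⇒; equivalence)
open import Function.Related.TypeIsomorphisms using (→-cong-⇔)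
open import Relation.Binary using (IsEquivalence)
open import Relation.Binary.PropositionalEquality as ≡ using (_≡_; refl; cong; cong₂)

open Equivalence using (to; from)

≡⇒⇔ : ∀ {A B : Set} → A ≡ B → A ⇔ B
≡⇒⇔ = ≡⇒ {k = equivalence}

Σ-cong-⇔ : ∀ {I : Set} {P Q : I → Set} → (∀ {i} → P i ⇔ Q i) → Σ I P ⇔ Σ I Q
Σ-cong-⇔ = congˡ {k = equivalence}

Π-cong-⇔ : ∀ {I : Set} {P Q : I → Set} → (∀ i → P i ⇔ Q i) → (∀ i → P i) ⇔ (∀ i → Q i)
Π-cong-⇔ e = mk⇔ (λ h i → to (e i) (h i)) (λ h i → from (e i) (h i))

local : ∀ n {Δ} → Fin n → obj ∈ replicate n obj ++ Δ
local (suc n) zero    = here refl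
local (suc n) (suc j) = there (local n j)

weaken : ∀ n {Δ s} → s ∈ Δ → s ∈ replicate n obj ++ Δ
weaken zero    x = x
weaken (suc n) x = there (weaken n x)

module _ {F : Set} where

  ∃ⁿ : ∀ n {Γ} → Formula F (replicate n obj ++ Γ) → Formula F Γ
  ∃ⁿ zero    φ = φ
  ∃ⁿ (suc n) φ = ∃ⁿ n (∃ᶠ obj φ)

  ∀ⁿ : ∀ n {Γ} → Formula F (replicate n obj ++ Γ) → Formula F Γ
  ∀ⁿ zero    φ = φ
  ∀ⁿ (suc n) φ = ∀ⁿ n (∀ᶠ obj φ)

  ⋀ : ∀ n {Γ} → (Fin n → Formula F Γ) → Formula F Γ
  ⋀ zero    φs = ⊤ᶠ
  ⋀ (suc n) φs = φs zero ∧ᶠ ⋀ n (φs ∘ suc)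

  ∋-locals : ∀ {k Δ} → rel k ∈ Δ → Formula F (replicate (suc k) obj ++ Δ)
  ∋-locals {k} X = app (weaken (suc k) X) (var ∘ local (suc k))

module FormulaSemantics {F : Set} (A : Structure F) where
  open Structure A
  open Semantics A
  open IsEquivalence ≈-eq using (reflexive) renaming (refl to ≈-refl)

  lookup-local : ∀ n {Γ} (v : Fin n → M) (ρ : Env Γ) j →
                 lookup (extend n v ρ) (local n j) ≡ v j
  lookup-local (suc n) v ρ zero    = refl
  lookup-local (suc n) v ρ (suc j) = lookup-local n (v ∘ suc) ρ j

  lookup-weaken : ∀ n {Γ s} (v : Fin n → M) (ρ : Env Γ) (x : s ∈ Γ) →
                  lookup (extend n v ρ) (weaken n x) ≡ lookup ρ x
  lookup-weaken zero    v ρ x = refl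
  lookup-weaken (suc n) v ρ x = lookup-weaken n (v ∘ suc) ρ x

  ∃ⁿ-sat : ∀ n {Γ} (φ : Formula F (replicate n obj ++ Γ)) (ρ : Env Γ) →
           Sat (∃ⁿ n φ) ρ ⇔ Σ (Fin n → M) λ v → Sat φ (extend n v ρ)
  ∃ⁿ-sat zero    φ ρ = mk⇔ (λ s → (λ ()) , s) proj₂
  ∃ⁿ-sat (suc n) φ ρ =
    mk⇔ (λ (u , d , s) → d ◂ u , s) (λ (v , s) → v ∘ suc , v zero , s)
      ⇔-∘ ∃ⁿ-sat n (∃ᶠ obj φ) ρ

  ∀ⁿ-sat : ∀ n {Γ} (φ : Formula F (replicate n obj ++ Γ)) (ρ : Env Γ) →
           Sat (∀ⁿ n φ) ρ ⇔ (∀ (v : Fin n → M) → Sat φ (extend n v ρ))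
  ∀ⁿ-sat zero    φ ρ = mk⇔ (λ s _ → s) (λ h → h (λ ()))
  ∀ⁿ-sat (suc n) φ ρ =
    mk⇔ (λ h v → h (v ∘ suc) (v zero)) (λ h u d → h (d ◂ u))
      ⇔-∘ ∀ⁿ-sat n (∀ᶠ obj φ) ρ

  ⋀-sat : ∀ n {Γ} (φs : Fin n → Formula F Γ) (ρ : Env Γ) →
          Sat (⋀ n φs) ρ ⇔ (∀ j → Sat (φs j) ρ)
  ⋀-sat zero    φs ρ = mk⇔ (λ _ ()) _
  ⋀-sat (suc n) φs ρ =
    mk⇔ split (λ h → h zero , h ∘ suc) ⇔-∘ (⇔-id _ ×-⇔ ⋀-sat n (φs ∘ suc) ρ)
    where
      split : Sat (φs zero) ρ × (∀ j → Sat (φs (suc j)) ρ) → ∀ j → Sat (φs j) ρ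
      split (s , h) zero    = s
      split (s , h) (suc j) = h j

  ∋-locals-sat : ∀ {k Γ} (X : rel k ∈ Γ) (v : Fin (suc k) → M) (ρ : Env Γ) →
                 Sat (∋-locals X) (extend (suc k) v ρ) ⇔ (lookup ρ X ∋ v)
  ∋-locals-sat {k} X v ρ =
    ≡⇒⇔ (cong (_∋ v) (lookup-weaken (suc k) v ρ X))
      ⇔-∘ mk⇔ (∋-resp _ (reflexive ∘ lookup-local (suc k) v ρ))
              (∋-resp _ (reflexive ∘ ≡.sym ∘ lookup-local (suc k) v ρ))

  record DefinableRel : Set₁ where
    field
      holds       : M → M → Set
      formula     : ∀ {Δ} → obj ∈ Δ → obj ∈ Δ → Formula F Δ
      formula-sat : ∀ {Δ} (x y : obj ∈ Δ) (ρ : Env Δ) →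
                    Sat (formula x y) ρ ⇔ holds (lookup ρ x) (lookup ρ y)

  open DefinableRel

  _˘ : DefinableRel → DefinableRel
  θ ˘ = record
    { holds       = λ a b → holds θ b a
    ; formula     = λ x y → formula θ y x
    ; formula-sat = λ x y → formula-sat θ y x
    }

  Functional Injective : (M → M → Set) → Set
  Functional _~_ = ∀ {a b b′} → a ~ b → a ~ b′ → b ≈ b′
  Injective  _~_ = ∀ {a a′ b} → a ~ b → a′ ~ b → a ≈ a′

  module Images (comp : Comprehension) where

    module _ (k : ℕ) (θ : DefinableRel) where
      private
        Δ = replicate (suc k) obj ++ rel k ∷ []

      relatedᶠ : Fin (suc k) → Formula F (replicate (suc k) obj ++ Δ)
      relatedᶠ j = formula θ (local (suc k) j) (weaken (suc k) (local (suc k) j))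

      -- w̄ ∈ R ∧ ⋀ⱼ θ(wⱼ, vⱼ), with w̄ the innermost variables and v̄ the next ones
      image-bodyᶠ : Formula F (replicate (suc k) obj ++ Δ)
      image-bodyᶠ = ∋-locals (weaken (suc k) (here refl)) ∧ᶠ ⋀ (suc k) relatedᶠ

      imageᶠ : Formula F Δ
      imageᶠ = ∃ⁿ (suc k) image-bodyᶠ

    image : ∀ {k} → DefinableRel → Rel k → Rel k
    image {k} θ R = proj₁ (comp (rel k ∷ []) k (imageᶠ k θ) (R ∷ []))

    ∈-image : ∀ {k} θ (R : Rel k) v →
              (image θ R ∋ v) ⇔ (Σ (Fin (suc k) → M) λ w → R ∋ w × ∀ j → holds θ (w j) (v j))
    ∈-image {k} θ R v =
      Σ-cong-⇔ (λ {w} → member w ×-⇔ (Π-cong-⇔ (related w) ⇔-∘ ⋀-sat (suc k) (relatedᶠ k θ) _))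
        ⇔-∘ (∃ⁿ-sat (suc k) (image-bodyᶠ k θ) ρ ⇔-∘ proj₂ (comp _ k (imageᶠ k θ) (R ∷ [])) v)
      where
        ρ = extend (suc k) v (R ∷ [])
        member : ∀ w → Sat (∋-locals (weaken (suc k) (here refl))) (extend (suc k) w ρ) ⇔ (R ∋ w)
        member w = ≡⇒⇔ (cong (_∋ w) (lookup-weaken (suc k) v (R ∷ []) (here refl)))
                     ⇔-∘ ∋-locals-sat _ w ρ
        related : ∀ w j → Sat (relatedᶠ k θ j) (extend (suc k) w ρ) ⇔ holds θ (w j) (v j)
        related w j =
          ≡⇒⇔ (cong₂ (holds θ) (lookup-local (suc k) w ρ j)
                 (≡.trans (lookup-weaken (suc k) w ρ _) (lookup-local (suc k) v (R ∷ []) j)))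
            ⇔-∘ formula-sat θ _ _ _

    image-⊆-range : ∀ {k} θ (R : Rel k) v → image θ R ∋ v → ∀ j → ∃[ a ] holds θ a (v j)
    image-⊆-range θ R v m j = let (w , _ , θwv) = to (∈-image θ R v) m in w j , θwv j

    image-∋-related : ∀ {k} θ {R : Rel k} {w v} → Injective (holds θ) →
                      (∀ j → holds θ (w j) (v j)) → (image θ R ∋ v) ⇔ (R ∋ w)
    image-∋-related θ {R} {w} {v} inj θwv = mk⇔
      (λ m → let (w′ , m′ , θw′v) = to (∈-image θ R v) m in
               ∋-resp R (λ j → inj (θw′v j) (θwv j)) m′)
      (λ m → from (∈-image θ R v) (w , m , θwv))

    image-image˘ : ∀ {k} θ (R : Rel k) → Functional (holds θ) →
                   (∀ v → R ∋ v → ∀ j → ∃[ a ] holds θ a (v j)) → image θ (image (θ ˘) R) ≐ R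
    image-image˘ θ R fun covered v = mk⇔
      (λ m → let (w , m′ , θwv) = to (∈-image θ _ v) m in to (image-∋-related (θ ˘) fun θwv) m′)
      (λ m → let w = λ j → proj₁ (covered v m j) ; θwv = λ j → proj₂ (covered v m j) in
        from (∈-image θ _ v) (w , from (∈-image (θ ˘) R w) (v , m , θwv) , θwv))

    graphᶠ : DefinableRel → Formula F (obj ∷ obj ∷ rel 0 ∷ [])
    graphᶠ θ = app (there (there (here refl))) (λ _ → var (here refl))
                 ∧ᶠ formula θ (here refl) (there (here refl))

    graph : DefinableRel → Rel 0 → Rel 1
    graph θ P = proj₁ (comp (rel 0 ∷ []) 1 (graphᶠ θ) (P ∷ []))

    ∈-graph : ∀ θ P a b → (graph θ P ∋ pair a b) ⇔ ((P ∋ λ _ → a) × holds θ a b)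
    ∈-graph θ P a b =
      (⇔-id _ ×-⇔ formula-sat θ _ _ _) ⇔-∘ proj₂ (comp _ 1 (graphᶠ θ) (P ∷ [])) (pair a b)

    graph-isBijGraph : ∀ θ P → Functional (holds θ) → Injective (holds θ) →
                       (∀ a → (P ∋ λ _ → a) → ∃[ b ] holds θ a b) →
                       IsBijGraph (graph θ P) P (image θ P)
    graph-isBijGraph θ P fun inj total =
        (λ a b m → let (Pa , θab) = to (∈-graph θ P a b) m in
                     Pa , from (∈-image θ P _) ((λ _ → a) , Pa , λ _ → θab))
      , (λ a Pa → let (b , θab) = total a Pa in b , from (∈-graph θ P a b) (Pa , θab))
      , (λ a b b′ m m′ → fun (related m) (related m′))
      , (λ a a′ b m m′ → inj (related m) (related m′))
      , (λ b m → let (w , Pw , θwb) = to (∈-image θ P _) m in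
                   w zero , from (∈-graph θ P _ b) (∋-resp P (λ { zero → ≈-refl }) Pw , θwb zero))
      where
        related : ∀ {a b} → graph θ P ∋ pair a b → holds θ a b
        related = proj₂ ∘ to (∈-graph θ P _ _)

module _ {F F′ : Set} (A : Structure F) (σ : F′ → F) where
  open Structure A
  open IsEquivalence ≈-eq using () renaming (refl to ≈-refl)
  private
    module A  = Semantics A
    module Aσ = Semantics (reduct A σ)

  IsBijGraph-reduct : ∀ {R X Y} → A.IsBijGraph R X Y ⇔ Aσ.IsBijGraph R X Y
  IsBijGraph-reduct {R} = mk⇔
    (λ (b₁ , b₂ , b₃ , b₄ , b₅) →
        (λ a b → b₁ a b ∘ ⇐) , (λ a → map₂ ⇒ ∘ b₂ a)
      , (λ a b b′ m m′ → b₃ a b b′ (⇐ m) (⇐ m′))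
      , (λ a a′ b m m′ → b₄ a a′ b (⇐ m) (⇐ m′))
      , (λ b → map₂ ⇒ ∘ b₅ b))
    (λ (b₁ , b₂ , b₃ , b₄ , b₅) →
        (λ a b → b₁ a b ∘ ⇒) , (λ a → map₂ ⇐ ∘ b₂ a)
      , (λ a b b′ m m′ → b₃ a b b′ (⇒ m) (⇒ m′))
      , (λ a a′ b m m′ → b₄ a a′ b (⇒ m) (⇒ m′))
      , (λ b → map₂ ⇐ ∘ b₅ b))
    where
      ⇒ : ∀ {a b} → R ∋ A.pair a b → R ∋ Aσ.pair a b
      ⇒ = ∋-resp R λ { zero → ≈-refl ; (suc zero) → ≈-refl }
      ⇐ : ∀ {a b} → R ∋ Aσ.pair a b → R ∋ A.pair a b
      ⇐ = ∋-resp R λ { zero → ≈-refl ; (suc zero) → ≈-refl }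

module Relativisation (A : Structure Bool) (i : Bool) where
  open Structure A
  open Semantics A
  open FormulaSemantics A
  open Sub A i using (InRng; Mᵢ; Relᵢ)
  open IsEquivalence ≈-eq using (reflexive) renaming (refl to ≈-refl; sym to ≈-sym)
  private
    module 𝒩ᵢ = Semantics (𝒩 A i)
    module Aᵢ = Semantics (single A i)

  ∈rngᶠ : ∀ {Δ} → obj ∈ Δ → Formula Bool Δ
  ∈rngᶠ x = ∃ᶠ (rel 0) (hash i (here refl) ≐ₜ var (there x))

  locals-∈rngᶠ : ∀ k Δ → Formula Bool (replicate (suc k) obj ++ Δ)
  locals-∈rngᶠ k Δ = ⋀ (suc k) (∈rngᶠ ∘ local (suc k))

  ⊆rngᶠ : ∀ {k Δ} → rel k ∈ Δ → Formula Bool Δ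
  ⊆rngᶠ {k} {Δ} X = ∀ⁿ (suc k) (∋-locals X ⇒ᶠ locals-∈rngᶠ k Δ)

  locals-∈rng-sat : ∀ {k Γ} (v : Fin (suc k) → M) (ρ : Env Γ) →
                    Sat (locals-∈rngᶠ k Γ) (extend (suc k) v ρ) ⇔ (∀ j → InRng (v j))
  locals-∈rng-sat {k} v ρ =
    Π-cong-⇔ (λ j → ≡⇒⇔ (cong InRng (lookup-local (suc k) v ρ j)))
      ⇔-∘ ⋀-sat (suc k) (∈rngᶠ ∘ local (suc k)) (extend (suc k) v ρ)

  ⊆rngᶠ-sat : ∀ {k Γ} (X : rel k ∈ Γ) (ρ : Env Γ) →
              Sat (⊆rngᶠ X) ρ ⇔ (∀ v → lookup ρ X ∋ v → ∀ j → InRng (v j))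
  ⊆rngᶠ-sat {k} {Γ} X ρ =
    Π-cong-⇔ (λ v → →-cong-⇔ (∋-locals-sat X v ρ) (locals-∈rng-sat v ρ))
      ⇔-∘ ∀ⁿ-sat (suc k) (∋-locals X ⇒ᶠ locals-∈rngᶠ k Γ) ρ

  relativiseᵗ : ∀ {Γ} → Term ⊤ Γ → Term Bool Γ
  relativiseᵗ (var x)    = var x
  relativiseᵗ (hash _ X) = hash i X

  relativise : ∀ {Γ} → Formula ⊤ Γ → Formula Bool Γ
  relativise (t ≐ₜ u)       = relativiseᵗ t ≐ₜ relativiseᵗ u
  relativise (app X ts)     = app X (relativiseᵗ ∘ ts)
  relativise ⊤ᶠ             = ⊤ᶠ
  relativise ⊥ᶠ             = ⊥ᶠ
  relativise (¬ᶠ φ)         = ¬ᶠ relativise φ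
  relativise (φ ∧ᶠ ψ)       = relativise φ ∧ᶠ relativise ψ
  relativise (φ ∨ᶠ ψ)       = relativise φ ∨ᶠ relativise ψ
  relativise (φ ⇒ᶠ ψ)       = relativise φ ⇒ᶠ relativise ψ
  relativise (∀ᶠ obj φ)     = ∀ᶠ obj (∈rngᶠ (here refl) ⇒ᶠ relativise φ)
  relativise (∃ᶠ obj φ)     = ∃ᶠ obj (∈rngᶠ (here refl) ∧ᶠ relativise φ)
  relativise (∀ᶠ (rel k) φ) = ∀ᶠ (rel k) (⊆rngᶠ (here refl) ⇒ᶠ relativise φ)
  relativise (∃ᶠ (rel k) φ) = ∃ᶠ (rel k) (⊆rngᶠ (here refl) ∧ᶠ relativise φ)

  forgetₛ : ∀ s → 𝒩ᵢ.⟦ s ⟧ˢ → ⟦ s ⟧ˢ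
  forgetₛ obj     = proj₁
  forgetₛ (rel k) = proj₁

  forget : ∀ {Γ} → 𝒩ᵢ.Env Γ → Env Γ
  forget []              = []
  forget {s ∷ Γ} (d ∷ ρ) = forgetₛ s d ∷ forget ρ

  lookup-forget : ∀ {Γ s} (ρ : 𝒩ᵢ.Env Γ) (x : s ∈ Γ) →
                  lookup (forget ρ) x ≡ forgetₛ s (lookup ρ x)
  lookup-forget (d ∷ ρ) (here refl) = refl
  lookup-forget (d ∷ ρ) (there x)   = lookup-forget ρ x

  evalT-relativise : ∀ {Γ} (t : Term ⊤ Γ) (ρ : 𝒩ᵢ.Env Γ) →
                     evalT (relativiseᵗ t) (forget ρ) ≡ proj₁ (𝒩ᵢ.evalT t ρ)
  evalT-relativise (var x)    ρ = lookup-forget ρ x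
  evalT-relativise (hash _ X) ρ = cong (# i) (lookup-forget ρ X)

  forget-extend : ∀ n {Γ} (v : Fin n → Mᵢ) (ρ : 𝒩ᵢ.Env Γ) →
                  forget (𝒩ᵢ.extend n v ρ) ≡ extend n (proj₁ ∘ v) (forget ρ)
  forget-extend zero    v ρ = refl
  forget-extend (suc n) v ρ = cong (proj₁ (v zero) ∷_) (forget-extend n (v ∘ suc) ρ)

  relativise-sat : ∀ {Γ} (φ : Formula ⊤ Γ) (ρ : 𝒩ᵢ.Env Γ) →
                   𝒩ᵢ.Sat φ ρ ⇔ Sat (relativise φ) (forget ρ)
  relativise-sat (t ≐ₜ u) ρ =
    ≡⇒⇔ (cong₂ _≈_ (≡.sym (evalT-relativise t ρ)) (≡.sym (evalT-relativise u ρ)))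
  relativise-sat (app X ts) ρ =
    ≡⇒⇔ (cong (_∋ _) (≡.sym (lookup-forget ρ X)))
      ⇔-∘ mk⇔ (∋-resp _ (reflexive ∘ ≡.sym ∘ eval)) (∋-resp _ (reflexive ∘ eval))
    where eval = λ j → evalT-relativise (ts j) ρ
  relativise-sat ⊤ᶠ       ρ = ⇔-id _
  relativise-sat ⊥ᶠ       ρ = ⇔-id _
  relativise-sat (¬ᶠ φ)   ρ = →-cong-⇔ (relativise-sat φ ρ) (⇔-id _)
  relativise-sat (φ ∧ᶠ ψ) ρ = relativise-sat φ ρ ×-⇔ relativise-sat ψ ρ
  relativise-sat (φ ∨ᶠ ψ) ρ = relativise-sat φ ρ ⊎-⇔ relativise-sat ψ ρ
  relativise-sat (φ ⇒ᶠ ψ) ρ = →-cong-⇔ (relativise-sat φ ρ) (relativise-sat ψ ρ)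
  relativise-sat (∀ᶠ obj φ) ρ = mk⇔
    (λ h d r → to (relativise-sat φ _) (h (d , r)))
    (λ h (d , r) → from (relativise-sat φ _) (h d r))
  relativise-sat (∃ᶠ obj φ) ρ = mk⇔
    (λ ((d , r) , s) → d , r , to (relativise-sat φ _) s)
    (λ (d , r , s) → (d , r) , from (relativise-sat φ _) s)
  relativise-sat (∀ᶠ (rel k) φ) ρ = mk⇔
    (λ h X X⊆ → to (relativise-sat φ _) (h (X , to (⊆rng X) X⊆)))
    (λ h (X , X⊆) → from (relativise-sat φ _) (h X (from (⊆rng X) X⊆)))
    where ⊆rng = λ X → ⊆rngᶠ-sat (here refl) (X ∷ forget ρ)
  relativise-sat (∃ᶠ (rel k) φ) ρ = mk⇔
    (λ ((X , X⊆) , s) → X , from (⊆rng X) X⊆ , to (relativise-sat φ _) s)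
    (λ (X , X⊆ , s) → (X , to (⊆rng X) X⊆) , from (relativise-sat φ _) s)
    where ⊆rng = λ X → ⊆rngᶠ-sat (here refl) (X ∷ forget ρ)

  comprehension-𝒩 : Comprehension → 𝒩ᵢ.Comprehension
  comprehension-𝒩 comp Γ k φ ρ = (R , R⊆rng) , R-spec
    where
      c = comp Γ k (relativise φ ∧ᶠ locals-∈rngᶠ k Γ) (forget ρ)
      R = proj₁ c
      ∈R : ∀ v → (R ∋ v) ⇔ (Sat (relativise φ) (extend (suc k) v (forget ρ))
                             × ∀ j → InRng (v j))
      ∈R v = (⇔-id _ ×-⇔ locals-∈rng-sat v (forget ρ)) ⇔-∘ proj₂ c v
      R⊆rng : ∀ v → R ∋ v → ∀ j → InRng (v j)
      R⊆rng v = proj₂ ∘ to (∈R v)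
      forget-extend-⇔ : ∀ v → Sat (relativise φ) (forget (𝒩ᵢ.extend (suc k) v ρ))
                            ⇔ Sat (relativise φ) (extend (suc k) (proj₁ ∘ v) (forget ρ))
      forget-extend-⇔ v = ≡⇒⇔ (cong (Sat (relativise φ)) (forget-extend (suc k) v ρ))
      R-spec : ∀ v → (R ∋ (proj₁ ∘ v)) ⇔ 𝒩ᵢ.Sat φ (𝒩ᵢ.extend (suc k) v ρ)
      R-spec v = ⇔-sym (relativise-sat φ _) ⇔-∘ (⇔-sym (forget-extend-⇔ v) ⇔-∘
        mk⇔ (proj₁ ∘ to (∈R _)) (λ s → from (∈R _) (s , proj₂ ∘ v)))

  -- A bijection graph between subsets of rng(#ᵢ) relates only elements of
  -- rng(#ᵢ), so it is a binary relation of 𝒩ᵢ.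
  bijGraph-𝒩⇔ : (X Y : Relᵢ 0) →
                (∃[ R ] 𝒩ᵢ.IsBijGraph R X Y) ⇔ (∃[ R ] Aᵢ.IsBijGraph R (proj₁ X) (proj₁ Y))
  bijGraph-𝒩⇔ (X , X⊆) (Y , Y⊆) = mk⇔ down up
    where
      pair-coords : ∀ {a b : Mᵢ} j → proj₁ (𝒩ᵢ.pair a b j) ≈ Aᵢ.pair (proj₁ a) (proj₁ b) j
      pair-coords zero       = ≈-refl
      pair-coords (suc zero) = ≈-refl
      via : ∀ {R : Rel 1} {a b : Mᵢ} →
            (R ∋ (proj₁ ∘ 𝒩ᵢ.pair a b)) ⇔ (R ∋ Aᵢ.pair (proj₁ a) (proj₁ b))
      via {R} = mk⇔ (∋-resp R pair-coords) (∋-resp R (≈-sym ∘ pair-coords))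
      down : (∃[ R ] 𝒩ᵢ.IsBijGraph R (X , X⊆) (Y , Y⊆)) → ∃[ R ] Aᵢ.IsBijGraph R X Y
      down ((R , R⊆) , c₁ , c₂ , c₃ , c₄ , c₅) = R
        , (λ a b m → c₁ (a , R⊆ _ m zero) (b , R⊆ _ m (suc zero)) (from via m))
        , (λ a Xa → let (b , m) = c₂ (a , X⊆ _ Xa zero) Xa in proj₁ b , to via m)
        , (λ a b b′ m m′ → c₃ (a , R⊆ _ m zero) (b , R⊆ _ m (suc zero)) (b′ , R⊆ _ m′ (suc zero))
                              (from via m) (from via m′))
        , (λ a a′ b m m′ → c₄ (a , R⊆ _ m zero) (a′ , R⊆ _ m′ zero) (b , R⊆ _ m (suc zero))
                              (from via m) (from via m′))
        , (λ b Yb → let (a , m) = c₅ (b , Y⊆ _ Yb zero) Yb in proj₁ a , to via m)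
      up : (∃[ R ] Aᵢ.IsBijGraph R X Y) → ∃[ R ] 𝒩ᵢ.IsBijGraph R (X , X⊆) (Y , Y⊆)
      up (R , b₁ , b₂ , b₃ , b₄ , b₅) = (R , R⊆)
        , (λ a b m → b₁ _ _ (to via m))
        , (λ a Xa → let (b , m) = b₂ (proj₁ a) Xa in
                      (b , Y⊆ _ (proj₂ (b₁ _ _ m)) zero) , from via m)
        , (λ a b b′ m m′ → b₃ _ _ _ (to via m) (to via m′))
        , (λ a a′ b m m′ → b₄ _ _ _ (to via m) (to via m′))
        , (λ b Yb → let (a , m) = b₅ (proj₁ b) Yb in
                      (a , X⊆ _ (proj₁ (b₁ _ _ m)) zero) , from via m)
        where
          as-pair : ∀ {v} → R ∋ v → R ∋ Aᵢ.pair (v zero) (v (suc zero))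
          as-pair = ∋-resp R λ { zero → ≈-refl ; (suc zero) → ≈-refl }
          R⊆ : ∀ v → R ∋ v → ∀ j → InRng (v j)
          R⊆ v m zero       = X⊆ _ (proj₁ (b₁ _ _ (as-pair m))) zero
          R⊆ v m (suc zero) = Y⊆ _ (proj₂ (b₁ _ _ (as-pair m))) zero

  HP-𝒩 : Aᵢ.HP tt → 𝒩ᵢ.HP tt
  HP-𝒩 hp X Y = ⇔-sym (bijGraph-𝒩⇔ X Y) ⇔-∘ hp (proj₁ X) (proj₁ Y)

  model-𝒩 : Aᵢ.HP tt → Comprehension → ModelHP2 (𝒩 A i)
  model-𝒩 hp comp = HP-𝒩 hp , comprehension-𝒩 comp

module Isomorphism (A : Structure Bool) where
  open Structure A
  open Semantics A
  open FormulaSemantics A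
  open IsEquivalence ≈-eq renaming (refl to ≈-refl; sym to ≈-sym; trans to ≈-trans)
  private
    module 𝒩₂ = Structure (𝒩 A false)
    module Sub₁ = Sub A true
    module Sub₂ = Sub A false

  #-agree : ∀ {i j X Y} → Semantics.HP (single A i) tt → Semantics.HP (single A j) tt →
            # i X ≈ # i Y → # j X ≈ # j Y
  #-agree {X = X} {Y} hpᵢ hpⱼ eq =
    from (hpⱼ X Y) (map₂ (to (IsBijGraph-reduct A _) ∘ from (IsBijGraph-reduct A _))
                         (to (hpᵢ X Y) eq))

  ↦-rel : DefinableRel
  ↦-rel = record
    { holds       = λ a b → Σ (Rel 0) λ Z → (# true Z ≈ a) × (# false Z ≈ b)
    ; formula     = λ x y → ∃ᶠ (rel 0) ((hash true (here refl) ≐ₜ var (there x))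
                                       ∧ᶠ (hash false (here refl) ≐ₜ var (there y)))
    ; formula-sat = λ x y ρ → ⇔-id _
    }

  open DefinableRel ↦-rel using () renaming (holds to _↦_)

  module _ (hp₁ : Semantics.HP (single A true) tt) (hp₂ : Semantics.HP (single A false) tt)
           (comp : Comprehension) where
    open Images comp

    ↦-functional : Functional _↦_
    ↦-functional (_ , a , b) (_ , a′ , b′) =
      ≈-trans (≈-sym b) (≈-trans (#-agree hp₁ hp₂ (≈-trans a (≈-sym a′))) b′)

    ↦-injective : Injective _↦_
    ↦-injective (_ , a , b) (_ , a′ , b′) =
      ≈-trans (≈-sym a) (≈-trans (#-agree hp₂ hp₁ (≈-trans b (≈-sym b′))) a′)

    f : Sub₁.Mᵢ → Sub₂.Mᵢ
    f (_ , Z , _) = # false Z , Z , ≈-refl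

    ↦f : ∀ d → proj₁ d ↦ proj₁ (f d)
    ↦f (_ , Z , e) = Z , e , ≈-refl

    f-resp : ∀ {d d′} → proj₁ d ≈ proj₁ d′ → proj₁ (f d) ≈ proj₁ (f d′)
    f-resp {_ , _ , e} {_ , _ , e′} p = #-agree hp₁ hp₂ (≈-trans e (≈-trans p (≈-sym e′)))

    f-inj : ∀ {d d′} → proj₁ (f d) ≈ proj₁ (f d′) → proj₁ d ≈ proj₁ d′
    f-inj {_ , _ , e} {_ , _ , e′} q = ≈-trans (≈-sym e) (≈-trans (#-agree hp₂ hp₁ q) e′)

    g : ∀ {k} → Sub₁.Relᵢ k → Sub₂.Relᵢ k
    g (R , _) = image ↦-rel R , λ v m j →
      let (_ , Z , _ , e) = image-⊆-range ↦-rel R v m j in Z , e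

    g-surj : ∀ {k} (Y : Sub₂.Relᵢ k) → ∃[ X ] 𝒩₂._≐_ (g X) Y
    g-surj (Y , Y⊆) =
        (image (↦-rel ˘) Y , λ v m j →
           let (_ , Z , e , _) = image-⊆-range (↦-rel ˘) Y v m j in Z , e)
      , λ v → image-image˘ ↦-rel Y ↦-functional
                (λ v m j → let (Z , e) = Y⊆ v m j in # true Z , Z , ≈-refl , e) (proj₁ ∘ v)

    #-pres : ∀ (X : Sub₁.Relᵢ 0) → # false (image ↦-rel (proj₁ X)) ≈ # false (proj₁ X)
    #-pres (P , P⊆) = ≈-sym (from (hp₂ P (image ↦-rel P))
      (graph ↦-rel P , to (IsBijGraph-reduct A _)
        (graph-isBijGraph ↦-rel P ↦-functional ↦-injective
          (λ a Pa → let (Z , e) = P⊆ (λ _ → a) Pa zero in # false Z , Z , e , ≈-refl))))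

    iso : Iso (𝒩 A true) (𝒩 A false)
    iso = record
      { f      = f
      ; f-resp = λ {d} {d′} → f-resp {d} {d′}
      ; f-inj  = λ {d} {d′} → f-inj {d} {d′}
      ; f-surj = λ (_ , Z , e) → (# true Z , Z , ≈-refl) , e
      ; g      = g
      ; g-surj = g-surj
      ; g-mem  = λ X v → ⇔-sym (image-∋-related ↦-rel ↦-injective (↦f ∘ v))
      ; #-pres = λ _ → #-pres
      }

proposition2p7 : ExcludedMiddle 0ℓ →
    (A : Structure Bool) →
    ModelHP2 (single A true) →
    ModelHP2 (single A false) →
    Semantics.Comprehension A →
    ModelHP2 (𝒩 A true) × ModelHP2 (𝒩 A false) × Iso (𝒩 A true) (𝒩 A false)
proposition2p7 _ A (hp₁ , _) (hp₂ , _) comp =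
    Relativisation.model-𝒩 A true hp₁ comp
  , Relativisation.model-𝒩 A false hp₂ comp
  , Isomorphism.iso A hp₁ hp₂ comp
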